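{- Let $G=(V,E)$ be a finite simple graph whose edges are colored red, green and blue, each edge receiving exactly one color. Let $R$, $G$, $B$ denote the numbers of red, green and blue edges, respectively, and let $T$ be the number of rainbow triangles in the graph. Then $T^2\leq 2RGB$.
   Context: A rainbow triangle is a set of three vertices that are pairwise adjacent and whose three connecting edges have three distinct colors (one red, one green, one blue). Simple means there are no loops and no multiple edges. -}

module Defs where

open import Data.Nat using (ℕ; zero; suc)
open import Data.Bool using (Bool; true; false; _∧_; if_then_else_)
open import Data.Fin using (Fin; _<?_)
open import Data.List using (List; []; _∷_; concatMap; length; filterᵇ; allFin)
open import Data.Maybe using (Maybe; just; nothing)
open import Data.Product using (_×_; _,_)
open import Relation.Nullary.Decidable using (⌊_⌋)
open import Relation.Binary.PropositionalEquality using (_≡_)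

data Colour : Set where
  red green blue : Colour

_≟ᶜ_ : Colour → Colour → Bool
red   ≟ᶜ red   = true
green ≟ᶜ green = true
blue  ≟ᶜ blue  = true
_     ≟ᶜ _     = false

-- A finite simple graph on vertex set Fin n whose edges are each coloured
-- with exactly one colour.  col i j = nothing means i and j are not
-- adjacent; col i j = just c means {i,j} is an edge of colour c.
-- Symmetry (undirected) and irreflexivity (no loops) are required; there
-- are no multiple edges since each pair carries at most one value.
record ColouredGraph (n : ℕ) : Set where
  field
    col    : Fin n → Fin n → Maybe Colour
    sym    : ∀ i j → col i j ≡ col j i
    noLoop : ∀ i → col i i ≡ nothing

open ColouredGraph public

pairs : (n : ℕ) → List (Fin n × Fin n)
pairs n = concatMap (λ i → concatMap (λ j →
            if ⌊ i <? j ⌋ then (i , j) ∷ [] else []) (allFin n)) (allFin n)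

triples : (n : ℕ) → List (Fin n × Fin n × Fin n)
triples n = concatMap (λ i → concatMap (λ j → concatMap (λ k →
              if ⌊ i <? j ⌋ ∧ ⌊ j <? k ⌋ then (i , j , k) ∷ [] else [])
              (allFin n)) (allFin n)) (allFin n)

hasColour : Colour → Maybe Colour → Bool
hasColour c (just d) = c ≟ᶜ d
hasColour c nothing  = false

numEdges : ∀ {n} → ColouredGraph n → Colour → ℕ
numEdges {n} G c = length (filterᵇ (λ { (i , j) → hasColour c (col G i j) }) (pairs n))

rainbow : Maybe Colour → Maybe Colour → Maybe Colour → Bool
rainbow (just a) (just b) (just c) =
  (if a ≟ᶜ b then false else true) ∧
  (if b ≟ᶜ c then false else true) ∧
  (if a ≟ᶜ c then false else true)
rainbow _ _ _ = false

numRainbow : ∀ {n} → ColouredGraph n → ℕ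
numRainbow {n} G = length (filterᵇ
  (λ { (i , j , k) → rainbow (col G i j) (col G j k) (col G i k) }) (triples n))

-- Call an ordered triple (x, y, z) rgb when xy is red, xz green and yz blue.  Each rainbow
-- triangle is rgb in exactly one of its six orderings, so T ≤ ∑_{x,y} r(x,y) c(x,y), where r is
-- the red indicator on ordered pairs and c(x,y) counts the z with xz green and yz blue.
-- Cauchy–Schwarz gives T² ≤ (∑ r)(∑ r c²).  The sum ∑ r c² counts pairs of rgb triples
-- (x, y, z), (x, y, w) on a common red edge; such a pair determines the green edge xz and the
-- blue edge yw, and for fixed edges pq green and st blue at most one of the four ways of
-- orienting them arises, so 4 ∑ r c² ≤ (∑ g)(∑ b).  An indicator summed over ordered pairs
-- counts every edge twice, hence 4T² ≤ 2R · 2G · 2B.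

{-# OPTIONS --safe #-}
module Submission where

open import Defs hiding (sym)
open import Data.Nat using (ℕ; zero; suc; _+_; _*_; _≤_; _≤?_; z≤n)
open import Data.Nat.Properties hiding (_<?_)
open import Data.Nat.Tactic.RingSolver using (solve-∀)
open import Data.Bool using (Bool; true; false; _∧_; not; if_then_else_; T)
open import Data.Bool.Properties using (T-∧; T-≡)
open import Data.Fin using (Fin; zero; suc; _<_; _<?_)
import Data.Fin.Properties as Fin
open import Data.List using (List; []; _∷_; _++_; length; concatMap; filterᵇ; allFin; tabulate)
open import Data.List.Properties using (length-++; filter-++)
open import Data.List.Membership.Propositional using (_∈_)
open import Data.List.Relation.Unary.Any using (here; there)
import Data.List.Relation.Unary.All as All
open import Data.Maybe using (Maybe; just; nothing)
open import Data.Product using (_×_; _,_)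
open import Data.Sum using ([_,_]′)
open import Function using (id; _∘_; flip; Equivalence)
open import Relation.Binary.Definitions using (tri<; tri≈; tri>)
open import Relation.Binary.PropositionalEquality
open import Relation.Nullary using (Dec; yes; no; contradiction)
open import Relation.Nullary.Decidable using (⌊_⌋; map′; toWitness; fromWitness; T?; _→-dec_)
open import Algebra.Properties.Semiring.Sum +-*-semiring
  using (sum; sum-syntax; sum-cong-≗; ∑-distrib-+; ∑-comm; *-distribˡ-sum; *-distribʳ-sum)

⟦_⟧ : Bool → ℕ
⟦ true  ⟧ = 1
⟦ false ⟧ = 0

-- Finite sums

∑-mono-≤ : ∀ {n} {f g : Fin n → ℕ} → (∀ i → f i ≤ g i) → sum f ≤ sum g
∑-mono-≤ {zero}  f≤g = z≤n
∑-mono-≤ {suc n} f≤g = +-mono-≤ (f≤g zero) (∑-mono-≤ (f≤g ∘ suc))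

∑-*-∑ : ∀ {n} (f g : Fin n → ℕ) → sum f * sum g ≡ ∑[ i < n ] ∑[ j < n ] (f i * g j)
∑-*-∑ f g = trans (*-distribʳ-sum (sum g) f) (sum-cong-≗ λ i → *-distribˡ-sum (f i) g)

∑² : ∀ {n} → (Fin n → Fin n → ℕ) → ℕ
∑² {n} f = ∑[ i < n ] ∑[ j < n ] f i j

module _ {n : ℕ} where

  ∑²-cong : {f g : Fin n → Fin n → ℕ} → (∀ i j → f i j ≡ g i j) → ∑² f ≡ ∑² g
  ∑²-cong f≡g = sum-cong-≗ λ i → sum-cong-≗ (f≡g i)

  ∑²-mono-≤ : {f g : Fin n → Fin n → ℕ} → (∀ i j → f i j ≤ g i j) → ∑² f ≤ ∑² g
  ∑²-mono-≤ f≤g = ∑-mono-≤ λ i → ∑-mono-≤ (f≤g i)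

  ∑²-distrib-+ : (f g : Fin n → Fin n → ℕ) → ∑² (λ i j → f i j + g i j) ≡ ∑² f + ∑² g
  ∑²-distrib-+ f g =
    trans (sum-cong-≗ λ i → ∑-distrib-+ (f i) (g i)) (∑-distrib-+ (sum ∘ f) (sum ∘ g))

  ∑²-symmetrise : (f : Fin n → Fin n → ℕ) → 2 * ∑² f ≡ ∑² (λ i j → f i j + f j i)
  ∑²-symmetrise f = begin
    2 * ∑² f            ≡⟨ cong (∑² f +_) (+-identityʳ (∑² f)) ⟩
    ∑² f + ∑² f         ≡⟨ cong (∑² f +_) (∑-comm f) ⟩
    ∑² f + ∑² (flip f)  ≡⟨ ∑²-distrib-+ f (flip f) ⟨
    ∑² (λ i j → f i j + f j i) ∎
    where open ≡-Reasoning

  *-distribˡ-∑² : (c : ℕ) (f : Fin n → Fin n → ℕ) → c * ∑² f ≡ ∑² (λ i j → c * f i j)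
  *-distribˡ-∑² c f = trans (*-distribˡ-sum c (sum ∘ f)) (sum-cong-≗ λ i → *-distribˡ-sum c (f i))

  *-distribʳ-∑² : (c : ℕ) (f : Fin n → Fin n → ℕ) → ∑² f * c ≡ ∑² (λ i j → f i j * c)
  *-distribʳ-∑² c f = trans (*-distribʳ-sum c (sum ∘ f)) (sum-cong-≗ λ i → *-distribʳ-sum c (f i))

  ∑²-*-∑² : (f g : Fin n → Fin n → ℕ) → ∑² f * ∑² g ≡ ∑² (λ p q → ∑² (λ s t → f p q * g s t))
  ∑²-*-∑² f g = trans (*-distribʳ-∑² (∑² g) f) (∑²-cong λ p q → *-distribˡ-∑² (f p q) g)

  ∑²-∑²-symmetrise : (K : Fin n → Fin n → Fin n → Fin n → ℕ) →
    4 * ∑² (λ p q → ∑² (K p q)) ≡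
    ∑² (λ p q → ∑² (λ s t → K p q s t + K p q t s + (K q p s t + K q p t s)))
  ∑²-∑²-symmetrise K = begin
    4 * ∑² (λ p q → ∑² (K p q))          ≡⟨ *-assoc 2 2 (∑² λ p q → ∑² (K p q)) ⟩
    2 * (2 * ∑² (λ p q → ∑² (K p q)))    ≡⟨ cong (2 *_) (*-distribˡ-∑² 2 λ p q → ∑² (K p q)) ⟩
    2 * ∑² (λ p q → 2 * ∑² (K p q))      ≡⟨ cong (2 *_) (∑²-cong λ p q → ∑²-symmetrise (K p q)) ⟩
    2 * ∑² (λ p q → ∑² (L p q))          ≡⟨ ∑²-symmetrise (λ p q → ∑² (L p q)) ⟩
    ∑² (λ p q → ∑² (L p q) + ∑² (L q p)) ≡⟨ ∑²-cong (λ p q → ∑²-distrib-+ (L p q) (L q p)) ⟨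
    ∑² (λ p q → ∑² (λ s t → L p q s t + L q p s t)) ∎
    where
    open ≡-Reasoning
    L : Fin n → Fin n → Fin n → Fin n → ℕ
    L p q s t = K p q s t + K p q t s

∑³ : ∀ {n} → (Fin n → Fin n → Fin n → ℕ) → ℕ
∑³ {n} f = ∑[ i < n ] ∑² (f i)

module _ {n : ℕ} where

  ∑³-cong : {f g : Fin n → Fin n → Fin n → ℕ} → (∀ i j k → f i j k ≡ g i j k) → ∑³ f ≡ ∑³ g
  ∑³-cong f≡g = sum-cong-≗ λ i → ∑²-cong (f≡g i)

  ∑³-mono-≤ : {f g : Fin n → Fin n → Fin n → ℕ} → (∀ i j k → f i j k ≤ g i j k) → ∑³ f ≤ ∑³ g
  ∑³-mono-≤ f≤g = ∑-mono-≤ λ i → ∑²-mono-≤ (f≤g i)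

  ∑³-distrib-+ : (f g : Fin n → Fin n → Fin n → ℕ) →
                 ∑³ (λ i j k → f i j k + g i j k) ≡ ∑³ f + ∑³ g
  ∑³-distrib-+ f g =
    trans (sum-cong-≗ λ i → ∑²-distrib-+ (f i) (g i)) (∑-distrib-+ (∑² ∘ f) (∑² ∘ g))

  ∑³-+₆-cong : {a₁ a₂ a₃ a₄ a₅ a₆ b₁ b₂ b₃ b₄ b₅ b₆ : Fin n → Fin n → Fin n → ℕ} →
    ∑³ a₁ ≡ ∑³ b₁ → ∑³ a₂ ≡ ∑³ b₂ → ∑³ a₃ ≡ ∑³ b₃ →
    ∑³ a₄ ≡ ∑³ b₄ → ∑³ a₅ ≡ ∑³ b₅ → ∑³ a₆ ≡ ∑³ b₆ →
    ∑³ (λ i j k → a₁ i j k + a₂ i j k + a₃ i j k + a₄ i j k + a₅ i j k + a₆ i j k) ≡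
    ∑³ (λ i j k → b₁ i j k + b₂ i j k + b₃ i j k + b₄ i j k + b₅ i j k + b₆ i j k)
  ∑³-+₆-cong {a₁} {a₂} {a₃} {a₄} {a₅} {a₆} {b₁} {b₂} {b₃} {b₄} {b₅} {b₆} e₁ e₂ e₃ e₄ e₅ e₆ =
    trans (expand a₁ a₂ a₃ a₄ a₅ a₆)
      (trans (cong₂ _+_ (cong₂ _+_ (cong₂ _+_ (cong₂ _+_ (cong₂ _+_ e₁ e₂) e₃) e₄) e₅) e₆)
        (sym (expand b₁ b₂ b₃ b₄ b₅ b₆)))
    where
    expand : ∀ c₁ c₂ c₃ c₄ c₅ c₆ →
      ∑³ (λ i j k → c₁ i j k + c₂ i j k + c₃ i j k + c₄ i j k + c₅ i j k + c₆ i j k) ≡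
      ∑³ c₁ + ∑³ c₂ + ∑³ c₃ + ∑³ c₄ + ∑³ c₅ + ∑³ c₆
    expand c₁ c₂ c₃ c₄ c₅ c₆ =
      trans (∑³-distrib-+ (λ i j k → c₁ i j k + c₂ i j k + c₃ i j k + c₄ i j k + c₅ i j k) c₆)
      (cong (_+ ∑³ c₆)
        (trans (∑³-distrib-+ (λ i j k → c₁ i j k + c₂ i j k + c₃ i j k + c₄ i j k) c₅)
        (cong (_+ ∑³ c₅)
          (trans (∑³-distrib-+ (λ i j k → c₁ i j k + c₂ i j k + c₃ i j k) c₄)
          (cong (_+ ∑³ c₄)
            (trans (∑³-distrib-+ (λ i j k → c₁ i j k + c₂ i j k) c₃)
            (cong (_+ ∑³ c₃) (∑³-distrib-+ c₁ c₂))))))))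

  ∑³-swap₁₂ : (f : Fin n → Fin n → Fin n → ℕ) → ∑³ f ≡ ∑³ (λ i j k → f j i k)
  ∑³-swap₁₂ f = ∑-comm λ i j → ∑[ k < n ] f i j k

  ∑³-swap₂₃ : (f : Fin n → Fin n → Fin n → ℕ) → ∑³ f ≡ ∑³ (λ i j k → f i k j)
  ∑³-swap₂₃ f = sum-cong-≗ λ i → ∑-comm (f i)

  ∑³-rotate : (f : Fin n → Fin n → Fin n → ℕ) → ∑³ f ≡ ∑³ (λ i j k → f k i j)
  ∑³-rotate f = trans (∑³-swap₁₂ f) (∑³-swap₂₃ λ i j k → f j i k)

  ∑³-rotate⁻¹ : (f : Fin n → Fin n → Fin n → ℕ) → ∑³ f ≡ ∑³ (λ i j k → f j k i)
  ∑³-rotate⁻¹ f = trans (∑³-swap₂₃ f) (∑³-swap₁₂ λ i j k → f i k j)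

  ∑³-reverse : (f : Fin n → Fin n → Fin n → ℕ) → ∑³ f ≡ ∑³ (λ i j k → f k j i)
  ∑³-reverse f = trans (∑³-rotate f) (∑³-swap₁₂ λ i j k → f k i j)

sym₃ : {A : Set} → (A → A → A → ℕ) → A → A → A → ℕ
sym₃ h x y z = h x y z + h x z y + h y x z + h y z x + h z x y + h z y x

∑³-sym₃ : ∀ {n} (w h : Fin n → Fin n → Fin n → ℕ) →
          ∑³ (λ i j k → w i j k * sym₃ h i j k) ≡ ∑³ (λ i j k → sym₃ w i j k * h i j k)
∑³-sym₃ w h =
  trans (∑³-cong λ i j k →
           distribute (w i j k) (h i j k) (h i k j) (h j i k) (h j k i) (h k i j) (h k j i))
  (trans (∑³-+₆-cong {a₁ = λ i j k → w i j k * h i j k} refl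
           (∑³-swap₂₃ λ i j k → w i j k * h i k j)
           (∑³-swap₁₂ λ i j k → w i j k * h j i k)
           (∑³-rotate λ i j k → w i j k * h j k i)
           (∑³-rotate⁻¹ λ i j k → w i j k * h k i j)
           (∑³-reverse λ i j k → w i j k * h k j i))
  (∑³-cong λ i j k →
     collect (h i j k) (w i j k) (w i k j) (w j i k) (w j k i) (w k i j) (w k j i)))
  where
  distribute : ∀ w a b c d e f →
    w * (a + b + c + d + e + f) ≡ w * a + w * b + w * c + w * d + w * e + w * f
  distribute = solve-∀
  -- the two 3-cycles are inverse to each other, so their weights trade places
  collect : ∀ h a b c d e f →
    a * h + b * h + c * h + e * h + d * h + f * h ≡ (a + b + c + d + e + f) * h
  collect = solve-∀

-- Cauchy–Schwarz

m*m≤n*n⇒m≤n : ∀ {m n} → m * m ≤ n * n → m ≤ n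
m*m≤n*n⇒m≤n {m} {n} m²≤n² with m ≤? n
... | yes m≤n = m≤n
... | no  m≰n = contradiction m²≤n² (<⇒≱ (*-mono-< (≰⇒> m≰n) (≰⇒> m≰n)))

4*[m*n]≤[m+n]*[m+n] : ∀ m n → 4 * (m * n) ≤ (m + n) * (m + n)
4*[m*n]≤[m+n]*[m+n] m n = [ ordered , (λ n≤m → subst₂ _≤_ (cong (4 *_) (*-comm n m))
                               (cong₂ _*_ (+-comm n m) (+-comm n m)) (ordered n≤m)) ]′ (≤-total m n)
  where
  ordered : ∀ {m n} → m ≤ n → 4 * (m * n) ≤ (m + n) * (m + n)
  ordered {m} m≤n with d , refl ← m≤n⇒∃[o]m+o≡n m≤n =
    subst (4 * (m * (m + d)) ≤_) (sym (square-expansion m d)) (m≤m+n _ (d * d))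
    where
    square-expansion : ∀ m d → (m + (m + d)) * (m + (m + d)) ≡ 4 * (m * (m + d)) + d * d
    square-expansion = solve-∀

cross-term-≤ : ∀ {a b u v u′ v′} → a * a ≤ u * v → b * b ≤ u′ * v′ → 2 * (a * b) ≤ u * v′ + u′ * v
cross-term-≤ {a} {b} {u} {v} {u′} {v′} a²≤uv b²≤u′v′ = m*m≤n*n⇒m≤n (begin
  (2 * (a * b)) * (2 * (a * b)) ≡⟨ square-of-double a b ⟩
  4 * ((a * a) * (b * b))       ≤⟨ *-monoʳ-≤ 4 (*-mono-≤ a²≤uv b²≤u′v′) ⟩
  4 * ((u * v) * (u′ * v′))     ≡⟨ regroup u v u′ v′ ⟩
  4 * ((u * v′) * (u′ * v))     ≤⟨ 4*[m*n]≤[m+n]*[m+n] (u * v′) (u′ * v) ⟩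
  (u * v′ + u′ * v) * (u * v′ + u′ * v) ∎)
  where
  open ≤-Reasoning
  square-of-double : ∀ a b → (2 * (a * b)) * (2 * (a * b)) ≡ 4 * ((a * a) * (b * b))
  square-of-double = solve-∀
  regroup : ∀ u v u′ v′ → 4 * ((u * v) * (u′ * v′)) ≡ 4 * ((u * v′) * (u′ * v))
  regroup = solve-∀

cauchy-schwarz : ∀ {n} (a u v : Fin n → ℕ) → (∀ i → a i * a i ≤ u i * v i) →
                 sum a * sum a ≤ sum u * sum v
cauchy-schwarz {zero}  a u v a²≤uv = z≤n
cauchy-schwarz {suc n} a u v a²≤uv =
  subst₂ _≤_ (sym (square-of-sum a₀ A)) (sym (product-of-sums u₀ v₀ U V))
    (+-mono-≤ (+-mono-≤ (a²≤uv zero) (cross-term-≤ {a₀} {A} {u₀} {v₀} {U} {V} (a²≤uv zero) ih)) ih)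
  where
  a₀ u₀ v₀ A U V : ℕ
  a₀ = a zero
  u₀ = u zero
  v₀ = v zero
  A = sum (a ∘ suc)
  U = sum (u ∘ suc)
  V = sum (v ∘ suc)
  ih : A * A ≤ U * V
  ih = cauchy-schwarz (a ∘ suc) (u ∘ suc) (v ∘ suc) (a²≤uv ∘ suc)
  square-of-sum : ∀ a A → (a + A) * (a + A) ≡ a * a + 2 * (a * A) + A * A
  square-of-sum = solve-∀
  product-of-sums : ∀ u v U V → (u + U) * (v + V) ≡ u * v + (u * V + U * v) + U * V
  product-of-sums = solve-∀

∑²-cauchy-schwarz : ∀ {n} (a u v : Fin n → Fin n → ℕ) → (∀ i j → a i j * a i j ≤ u i j * v i j) →
                    ∑² a * ∑² a ≤ ∑² u * ∑² v
∑²-cauchy-schwarz a u v a²≤uv =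
  cauchy-schwarz (sum ∘ a) (sum ∘ u) (sum ∘ v) λ i → cauchy-schwarz (a i) (u i) (v i) (a²≤uv i)

∀-dec : {A : Set} {P : A → Set} (xs : List A) → (∀ a → a ∈ xs) → (∀ a → Dec (P a)) →
        Dec (∀ a → P a)
∀-dec xs complete P? =
  map′ (λ all a → All.lookup all (complete a)) (λ ∀P → All.tabulate λ {a} _ → ∀P a) (All.all? P? xs)

∀-Bool? : {P : Bool → Set} → (∀ b → Dec (P b)) → Dec (∀ b → P b)
∀-Bool? = ∀-dec (false ∷ true ∷ []) λ where
  false → here refl
  true  → there (here refl)

∀-label? : {P : Maybe Colour → Set} → (∀ e → Dec (P e)) → Dec (∀ e → P e)
∀-label? = ∀-dec (nothing ∷ just red ∷ just green ∷ just blue ∷ []) λ where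
  nothing      → here refl
  (just red)   → there (here refl)
  (just green) → there (there (here refl))
  (just blue)  → there (there (there (here refl)))

-- Orderings of three vertices

acyclic : (xy yx yz zy xz zx : Bool) → Bool
acyclic xy yx yz zy xz zx =
  not (xy ∧ yx) ∧ not (yz ∧ zy) ∧ not (xz ∧ zx) ∧ not (xy ∧ yz ∧ zx) ∧ not (xz ∧ zy ∧ yx)

increasing-orderings≤1 : ∀ xy yx yz zy xz zx → T (acyclic xy yx yz zy xz zx) →
  ⟦ xy ∧ yz ⟧ + ⟦ xz ∧ zy ⟧ + ⟦ yx ∧ xz ⟧ + ⟦ yz ∧ zx ⟧ + ⟦ zx ∧ xy ⟧ + ⟦ zy ∧ yx ⟧ ≤ 1
increasing-orderings≤1 = toWitness {a? = ∀-Bool? λ _ → ∀-Bool? λ _ → ∀-Bool? λ _ →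
  ∀-Bool? λ _ → ∀-Bool? λ _ → ∀-Bool? λ _ → T? _ →-dec _ ≤? _} _

module _ {n : ℕ} where

  _<ᵇ_ : Fin n → Fin n → Bool
  i <ᵇ j = ⌊ i <? j ⌋

  <⇒<ᵇ≡true : ∀ {i j} → i < j → i <ᵇ j ≡ true
  <⇒<ᵇ≡true i<j = Equivalence.to T-≡ (fromWitness i<j)

  increasing : Fin n → Fin n → Fin n → ℕ
  increasing i j k = ⟦ i <ᵇ j ∧ j <ᵇ k ⟧

  no-2-cycle : ∀ x y → T (not (x <ᵇ y ∧ y <ᵇ x))
  no-2-cycle x y with x <? y | y <? x
  ... | yes x<y | yes y<x = Fin.<-asym x<y y<x
  ... | yes _   | no  _   = _
  ... | no  _   | _       = _

  no-3-cycle : ∀ x y z → T (not (x <ᵇ y ∧ y <ᵇ z ∧ z <ᵇ x))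
  no-3-cycle x y z with x <? y | y <? z | z <? x
  ... | yes x<y | yes y<z | yes z<x = Fin.<-asym (Fin.<-trans x<y y<z) z<x
  ... | yes _   | yes _   | no  _   = _
  ... | yes _   | no  _   | _       = _
  ... | no  _   | _       | _       = _

  <ᵇ-acyclic : ∀ x y z → T (acyclic (x <ᵇ y) (y <ᵇ x) (y <ᵇ z) (z <ᵇ y) (x <ᵇ z) (z <ᵇ x))
  <ᵇ-acyclic x y z =
    T-∧-intro (no-2-cycle x y) (T-∧-intro (no-2-cycle y z) (T-∧-intro (no-2-cycle x z)
      (T-∧-intro (no-3-cycle x y z) (no-3-cycle x z y))))
    where
    T-∧-intro : ∀ {a b} → T a → T b → T (a ∧ b)
    T-∧-intro p q = Equivalence.from T-∧ (p , q)

  sym₃-increasing≤1 : ∀ x y z → sym₃ increasing x y z ≤ 1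
  sym₃-increasing≤1 x y z =
    increasing-orderings≤1 (x <ᵇ y) (y <ᵇ x) (y <ᵇ z) (z <ᵇ y) (x <ᵇ z) (z <ᵇ x) (<ᵇ-acyclic x y z)

  ∑²≤2*∑²< : (f : Fin n → Fin n → ℕ) → (∀ i j → f i j ≡ f j i) → (∀ i → f i i ≡ 0) →
             ∑² f ≤ 2 * ∑² (λ i j → ⟦ i <ᵇ j ⟧ * f i j)
  ∑²≤2*∑²< f f-sym f-diag = begin
    ∑² f                        ≤⟨ ∑²-mono-≤ split ⟩
    ∑² (λ i j → g i j + g j i)  ≡⟨ ∑²-symmetrise g ⟨
    2 * ∑² g                    ∎
    where
    open ≤-Reasoning
    g : Fin n → Fin n → ℕ
    g i j = ⟦ i <ᵇ j ⟧ * f i j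
    split : ∀ i j → f i j ≤ g i j + g j i
    split i j with Fin.<-cmp i j
    ... | tri< i<j _ _ rewrite <⇒<ᵇ≡true i<j =
      ≤-trans (≤-reflexive (sym (*-identityˡ (f i j)))) (m≤m+n _ _)
    ... | tri≈ _ refl _ rewrite f-diag i = z≤n
    ... | tri> _ _ j<i rewrite <⇒<ᵇ≡true j<i | f-sym i j =
      ≤-trans (≤-reflexive (sym (*-identityˡ (f j i)))) (m≤n+m _ (⟦ i <ᵇ j ⟧ * f j i))

-- Counting edges and triangles

length-filterᵇ-concatMap-allFin : ∀ {n} {A : Set} (p : A → Bool) (f : Fin n → List A) →
  length (filterᵇ p (concatMap f (allFin n))) ≡ ∑[ i < n ] length (filterᵇ p (f i))
length-filterᵇ-concatMap-allFin {n} p f = tabulated id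
  where
  tabulated : ∀ {m} (g : Fin m → Fin n) →
    length (filterᵇ p (concatMap f (tabulate g))) ≡ ∑[ i < m ] length (filterᵇ p (f (g i)))
  tabulated {zero}  g = refl
  tabulated {suc m} g = begin
    length (filterᵇ p (f (g zero) ++ concatMap f (tabulate (g ∘ suc))))
      ≡⟨ cong length (filter-++ (T? ∘ p) (f (g zero)) _) ⟩
    length (filterᵇ p (f (g zero)) ++ filterᵇ p (concatMap f (tabulate (g ∘ suc))))
      ≡⟨ length-++ (filterᵇ p (f (g zero))) ⟩
    length (filterᵇ p (f (g zero))) + length (filterᵇ p (concatMap f (tabulate (g ∘ suc))))
      ≡⟨ cong (length (filterᵇ p (f (g zero))) +_) (tabulated (g ∘ suc)) ⟩
    ∑[ i < suc m ] length (filterᵇ p (f (g i))) ∎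
    where open ≡-Reasoning

length-filterᵇ-if : ∀ {A : Set} (p : A → Bool) b x →
  length (filterᵇ p (if b then x ∷ [] else [])) ≡ ⟦ b ⟧ * ⟦ p x ⟧
length-filterᵇ-if p false x = refl
length-filterᵇ-if p true  x with p x
... | true  = refl
... | false = refl

length-filterᵇ-pairs : ∀ {n} (p : Fin n × Fin n → Bool) →
  length (filterᵇ p (pairs n)) ≡ ∑² (λ i j → ⟦ i <ᵇ j ⟧ * ⟦ p (i , j) ⟧)
length-filterᵇ-pairs {n} p =
  trans (length-filterᵇ-concatMap-allFin {n} p _) (sum-cong-≗ λ i →
  trans (length-filterᵇ-concatMap-allFin {n} p _) (sum-cong-≗ λ j →
  length-filterᵇ-if p (i <ᵇ j) (i , j)))

length-filterᵇ-triples : ∀ {n} (p : Fin n × Fin n × Fin n → Bool) →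
  length (filterᵇ p (triples n)) ≡ ∑³ (λ i j k → increasing i j k * ⟦ p (i , j , k) ⟧)
length-filterᵇ-triples {n} p =
  trans (length-filterᵇ-concatMap-allFin {n} p _) (sum-cong-≗ λ i →
  trans (length-filterᵇ-concatMap-allFin {n} p _) (sum-cong-≗ λ j →
  trans (length-filterᵇ-concatMap-allFin {n} p _) (sum-cong-≗ λ k →
  length-filterᵇ-if p (i <ᵇ j ∧ j <ᵇ k) (i , j , k))))

isGB : Maybe Colour → Maybe Colour → ℕ
isGB g b = ⟦ hasColour green g ⟧ * ⟦ hasColour blue b ⟧

isRGB : Maybe Colour → Maybe Colour → Maybe Colour → ℕ
isRGB r g b = ⟦ hasColour red r ⟧ * isGB g b

isRGB² : Maybe Colour → Maybe Colour → Maybe Colour → Maybe Colour → Maybe Colour → ℕ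
isRGB² r g b g′ b′ = ⟦ hasColour red r ⟧ * (isGB g b * isGB g′ b′)

rainbow≤isRGB-assignments : ∀ a b c → ⟦ rainbow a b c ⟧ ≤
  isRGB a c b + isRGB c a b + isRGB a b c + isRGB b a c + isRGB c b a + isRGB b c a
rainbow≤isRGB-assignments =
  toWitness {a? = ∀-label? λ _ → ∀-label? λ _ → ∀-label? λ _ → _ ≤? _} _

-- Any two of the four summands ask for different colours on one of the edges ps, pt, qs, qt.
isRGB²-orientations≤ : ∀ pq ps pt qs qt st →
  isRGB² ps pq qs pt st + isRGB² pt pq qt ps st + (isRGB² qs pq ps qt st + isRGB² qt pq pt qs st)
    ≤ isGB pq st
isRGB²-orientations≤ = toWitness {a? = ∀-label? λ _ → ∀-label? λ _ → ∀-label? λ _ →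
                                        ∀-label? λ _ → ∀-label? λ _ → ∀-label? λ _ → _ ≤? _} _

module _ {n : ℕ} (G : ColouredGraph n) where

  χ : Colour → Fin n → Fin n → ℕ
  χ c i j = ⟦ hasColour c (col G i j) ⟧

  χ-sym : ∀ c i j → χ c i j ≡ χ c j i
  χ-sym c i j = cong (⟦_⟧ ∘ hasColour c) (ColouredGraph.sym G i j)

  χ-irrefl : ∀ c i → χ c i i ≡ 0
  χ-irrefl c i = cong (⟦_⟧ ∘ hasColour c) (noLoop G i)

  ∑²χ≤2*numEdges : ∀ c → ∑² (χ c) ≤ 2 * numEdges G c
  ∑²χ≤2*numEdges c = subst (λ m → ∑² (χ c) ≤ 2 * m) (sym (length-filterᵇ-pairs {n} _))
                       (∑²≤2*∑²< (χ c) (χ-sym c) (χ-irrefl c))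

  rgb : Fin n → Fin n → Fin n → ℕ
  rgb x y z = isRGB (col G x y) (col G x z) (col G y z)

  rainbow≤sym₃rgb : ∀ i j k → ⟦ rainbow (col G i j) (col G j k) (col G i k) ⟧ ≤ sym₃ rgb i j k
  rainbow≤sym₃rgb i j k
    rewrite ColouredGraph.sym G j i | ColouredGraph.sym G k j | ColouredGraph.sym G k i =
    rainbow≤isRGB-assignments (col G i j) (col G j k) (col G i k)

  numRainbow≤∑³rgb : numRainbow G ≤ ∑³ rgb
  numRainbow≤∑³rgb = begin
    numRainbow G
      ≡⟨ length-filterᵇ-triples {n} _ ⟩
    ∑³ (λ i j k → increasing i j k * ⟦ rainbow (col G i j) (col G j k) (col G i k) ⟧)
      ≤⟨ ∑³-mono-≤ (λ i j k → *-monoʳ-≤ (increasing i j k) (rainbow≤sym₃rgb i j k)) ⟩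
    ∑³ (λ i j k → increasing i j k * sym₃ rgb i j k)
      ≡⟨ ∑³-sym₃ increasing rgb ⟩
    ∑³ (λ i j k → sym₃ increasing i j k * rgb i j k)
      ≤⟨ ∑³-mono-≤ (λ i j k → *-monoˡ-≤ (rgb i j k) (sym₃-increasing≤1 i j k)) ⟩
    ∑³ (λ i j k → 1 * rgb i j k)
      ≡⟨ ∑³-cong (λ i j k → *-identityˡ (rgb i j k)) ⟩
    ∑³ rgb ∎
    where open ≤-Reasoning

  greenBlue : Fin n → Fin n → Fin n → ℕ
  greenBlue x y z = isGB (col G x z) (col G y z)

  completions : Fin n → Fin n → ℕ
  completions x y = ∑[ z < n ] greenBlue x y z

  squaredCompletions : ℕ
  squaredCompletions = ∑² (λ x y → χ red x y * (completions x y * completions x y))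

  numRainbow²≤∑²χred*squaredCompletions :
    numRainbow G * numRainbow G ≤ ∑² (χ red) * squaredCompletions
  numRainbow²≤∑²χred*squaredCompletions = begin
    numRainbow G * numRainbow G      ≤⟨ *-mono-≤ numRainbow≤M numRainbow≤M ⟩
    M * M                            ≤⟨ ∑²-cauchy-schwarz _ _ _ (λ x y → ≤-reflexive
                                           (square-split (χ red x y) (completions x y))) ⟩
    ∑² (χ red) * squaredCompletions  ∎
    where
    open ≤-Reasoning
    M : ℕ
    M = ∑² (λ x y → χ red x y * completions x y)
    numRainbow≤M : numRainbow G ≤ M
    numRainbow≤M = ≤-trans numRainbow≤∑³rgb (≤-reflexive (sum-cong-≗ λ x → sum-cong-≗ λ y →
                     sym (*-distribˡ-sum (χ red x y) (greenBlue x y))))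
    square-split : ∀ r a → (r * a) * (r * a) ≡ r * (r * (a * a))
    square-split = solve-∀

  rgb² : Fin n → Fin n → Fin n → Fin n → ℕ
  rgb² x y z w = isRGB² (col G x y) (col G x z) (col G y z) (col G x w) (col G y w)

  squaredCompletions≡∑²∑²rgb² : squaredCompletions ≡ ∑² (λ p q → ∑² (λ s t → rgb² p s q t))
  squaredCompletions≡∑²∑²rgb² =
    trans (∑²-cong λ x y → trans (cong (χ red x y *_) (∑-*-∑ (greenBlue x y) (greenBlue x y)))
                             (*-distribˡ-∑² (χ red x y) λ z w → greenBlue x y z * greenBlue x y w))
          (sum-cong-≗ λ x → ∑-comm λ y z → ∑[ w < n ] rgb² x y z w)

  rgb²-orientations≤ : ∀ p q s t →
    rgb² p s q t + rgb² p t q s + (rgb² q s p t + rgb² q t p s) ≤ χ green p q * χ blue s t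
  rgb²-orientations≤ p q s t
    rewrite ColouredGraph.sym G s q | ColouredGraph.sym G t q | ColouredGraph.sym G t s
          | ColouredGraph.sym G q p | ColouredGraph.sym G s p | ColouredGraph.sym G t p =
    isRGB²-orientations≤ (col G p q) (col G p s) (col G p t) (col G q s) (col G q t) (col G s t)

  4*squaredCompletions≤∑²χgreen*∑²χblue : 4 * squaredCompletions ≤ ∑² (χ green) * ∑² (χ blue)
  4*squaredCompletions≤∑²χgreen*∑²χblue = begin
    4 * squaredCompletions
      ≡⟨ cong (4 *_) squaredCompletions≡∑²∑²rgb² ⟩
    4 * ∑² (λ p q → ∑² (λ s t → rgb² p s q t))
      ≡⟨ ∑²-∑²-symmetrise (λ p q s t → rgb² p s q t) ⟩
    ∑² (λ p q → ∑² (λ s t → rgb² p s q t + rgb² p t q s + (rgb² q s p t + rgb² q t p s)))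
      ≤⟨ ∑²-mono-≤ (λ p q → ∑²-mono-≤ (rgb²-orientations≤ p q)) ⟩
    ∑² (λ p q → ∑² (λ s t → χ green p q * χ blue s t))
      ≡⟨ ∑²-*-∑² (χ green) (χ blue) ⟨
    ∑² (χ green) * ∑² (χ blue) ∎
    where open ≤-Reasoning

theorem1p1 : (n : ℕ) (G : ColouredGraph n) →
    numRainbow G * numRainbow G
      ≤ 2 * numEdges G red * numEdges G green * numEdges G blue
theorem1p1 n G = *-cancelˡ-≤ 4 (begin
  4 * (numRainbow G * numRainbow G)  ≤⟨ *-monoʳ-≤ 4 (numRainbow²≤∑²χred*squaredCompletions G) ⟩
  4 * (∑² (χ G red) * W)             ≡⟨ *-left-comm 4 (∑² (χ G red)) W ⟩
  ∑² (χ G red) * (4 * W)             ≤⟨ *-mono-≤ (∑²χ≤2*numEdges G red) green-blue ⟩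
  (2 * R) * ((2 * Gr) * (2 * B))     ≡⟨ regroup R Gr B ⟩
  4 * (2 * R * Gr * B)               ∎)
  where
  open ≤-Reasoning
  W R Gr B : ℕ
  W = squaredCompletions G
  R = numEdges G red
  Gr = numEdges G green
  B = numEdges G blue
  green-blue : 4 * W ≤ (2 * Gr) * (2 * B)
  green-blue = ≤-trans (4*squaredCompletions≤∑²χgreen*∑²χblue G)
                 (*-mono-≤ (∑²χ≤2*numEdges G green) (∑²χ≤2*numEdges G blue))
  *-left-comm : ∀ a b c → a * (b * c) ≡ b * (a * c)
  *-left-comm = solve-∀
  regroup : ∀ r g b → (2 * r) * ((2 * g) * (2 * b)) ≡ 4 * (2 * r * g * b)
  regroup = solve-∀
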